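{- Let $n$ be a positive integer and let $$W = \{(x_1, \dots, x_n, x_{n+1}) \in \mathbb{Z}^{n+1} : x_{n+1} - x_1^2 - \cdots - x_n^2 < 0\} \cup (\{(0, \dots, 0)\} \times \mathbb{Z}).$$ Then the set $M = \{(s_1, \dots, s_n, -2(s_1^2 + \cdots + s_n^2)) : (s_1, \dots, s_n) \in \mathbb{Z}^n\}$ is a minimal complement of $W$ in $\mathbb{Z}^{n+1}$. More generally, for any nonempty finite subset $A$ of $\mathbb{Z}^n$, the set $$\{(x_1, \dots, x_n, x_{n+1}) \in \mathbb{Z}^{n+1} : x_{n+1} - x_1^2 - \cdots - x_n^2 < 0\} \cup (A \times \mathbb{Z})$$ admits a minimal complement in $\mathbb{Z}^{n+1}$.
   Context: For an abelian group $G$ and nonempty subsets $W, W' \subseteq G$, $W'$ is a complement of $W$ in $G$ if $W + W' = G$; it is a minimal complement if moreover $W + (W' \setminus \{w'\}) \neq G$ for every $w' \in W'$. -}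

module Defs where

open import Data.Nat using (ℕ; suc)
open import Data.Integer using (ℤ; _+_; _*_; _-_; _<_; 0ℤ; -_; +_)
open import Data.Vec using (Vec; []; _∷_; _∷ʳ_; zipWith; replicate; foldr; map)
open import Data.List using (List)
open import Data.List.Membership.Propositional using (_∈_)
open import Data.Product using (Σ; ∃; ∃-syntax; _×_; _,_)
open import Data.Sum using (_⊎_)
open import Relation.Binary.PropositionalEquality using (_≡_; _≢_)
open import Relation.Nullary using (¬_)
open import Level using (0ℓ)

ℤ^ : ℕ → Set
ℤ^ m = Vec ℤ m

_⊕_ : ∀ {m} → ℤ^ m → ℤ^ m → ℤ^ m
_⊕_ = zipWith _+_

Subset : ℕ → Set₁
Subset m = ℤ^ m → Set

IsComplement : ∀ {m} → Subset m → Subset m → Set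
IsComplement {m} W W' = ∀ (g : ℤ^ m) → ∃[ w ] ∃[ w' ] (W w × W' w' × w ⊕ w' ≡ g)

NonEmpty : ∀ {m} → Subset m → Set
NonEmpty W = ∃[ w ] W w

IsMinimalComplement : ∀ {m} → Subset m → Subset m → Set
IsMinimalComplement W W' =
  IsComplement W W' ×
  (∀ w' → W' w' → ¬ IsComplement W (λ v → W' v × v ≢ w'))

sumSq : ∀ {n} → Vec ℤ n → ℤ
sumSq = foldr _ (λ x acc → x * x + acc) 0ℤ

BelowParaboloid : ∀ n → Subset (suc n)
BelowParaboloid n v = ∃[ x ] ∃[ t ] (v ≡ x ∷ʳ t × t - sumSq x < 0ℤ)

Cylinder : ∀ n → Subset n → Subset (suc n)
Cylinder n A v = ∃[ x ] ∃[ t ] (v ≡ x ∷ʳ t × A x)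

Wset : ∀ n → Subset n → Subset (suc n)
Wset n A v = BelowParaboloid n v ⊎ Cylinder n A v

Origin : ∀ n → Subset n
Origin n x = x ≡ replicate n 0ℤ

ListSet : ∀ {n} → List (ℤ^ n) → Subset n
ListSet xs x = x ∈ xs

Mset : ∀ n → Subset (suc n)
Mset n v = ∃[ s ] (v ≡ s ∷ʳ (- (+ 2 * sumSq s)))

module Submission where

-- Call S ⊆ ℤⁿ a witnessed minimal complement of A ⊆ ℤⁿ if A + S = ℤⁿ and every
-- s₀ ∈ S has a private point y: each representation y = a + s (a ∈ A, s ∈ S) has
-- s = s₀.
--
-- Put every s ∈ S onto the paraboloid, lift s = (s, -2|s|²).  The lifted
-- set is a minimal complement of W = {t < |x|²} ∪ (A × ℤ): the cylinder A × ℤ alone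
-- already covers, and the point (y, 2|y|²) above a private point y of s₀ cannot
-- be reached from the part of W below the paraboloid, because
-- |x|² ≤ 2|x + s|² + 2|s|², so it is reached only from lift s₀.
--
-- Part one applies this to A = {0}, S = ℤⁿ.  For part two a finite A ⊆ ℤⁿ is
-- mapped into ℤ by an additive "digits" map that is injective on A; a finite
-- B ⊆ ℤ has a witnessed minimal complement built greedily on both half-lines
-- (each half-line offset set is difference-free with respect to B - min B), and
-- witnessed minimal complements pull back along such maps.

open import Defs
open import Data.Nat using (ℕ; suc)
open import Data.List using (List; []; _∷_; map)
open import Data.Product using (_×_; ∃-syntax; _,_; proj₁; proj₂)
open import Relation.Binary.PropositionalEquality
  using (_≢_; _≡_; refl; sym; trans; cong; cong₂; subst; module ≡-Reasoning)

import Data.Nat as ℕ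
import Data.Nat.Properties as ℕP
open import Data.Integer
  using (ℤ; +_; _+_; _-_; _*_; -_; _≤_; _<_; 0ℤ; 1ℤ; ∣_∣; +≤+; -[1+_]; _≤?_)
import Data.Integer.Properties as ℤP
open import Algebra.Properties.AbelianGroup ℤP.+-0-abelianGroup
  using () renaming (∙-cancelˡ to +-cancelˡ; ∙-cancelʳ to +-cancelʳ)
open import Data.Integer.Tactic.RingSolver using (solve-∀; solve)
open import Data.List.Membership.Propositional using (_∈_; find; lose)
open import Data.List.Membership.Propositional.Properties using (∈-map⁺; ∈-map⁻)
open import Data.List.Relation.Unary.Any using (Any; here; there; any?)
import Data.List.Relation.Unary.All as ListAll
import Data.List.Extrema
open import Data.Vec using (_∷ʳ_; replicate; zipWith; initLast; head; tail)
  renaming ([] to []ᵥ; _∷_ to _∷ᵥ_)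
open import Data.Vec.Properties using (∷ʳ-injective; zipWith-identityˡ)
open import Data.Vec.Relation.Unary.All using (All) renaming ([] to []ᵃ; _∷_ to _∷ᵃ_)
open import Data.Sum using (_⊎_; inj₁; inj₂)
open import Data.Unit using (⊤; tt)
open import Data.Empty using (⊥-elim)
open import Relation.Nullary using (¬_; Dec; yes; no)
open import Relation.Nullary.Decidable using (_×-dec_)

-- Linear rearrangement: L ≡ R yields L' ≡ R' whenever L' - R' ≡ L - R holds as a
-- polynomial identity (which the ring solver discharges at each use).
rearrange : ∀ {L R L' R' : ℤ} → L ≡ R → L' - R' ≡ L - R → L' ≡ R'
rearrange {L} {R} {L'} {R'} eq diff = ℤP.i-j≡0⇒i≡j L' R' (trans diff (ℤP.i≡j⇒i-j≡0 eq))

≤-from-difference : ∀ {i j X : ℤ} → 0ℤ ≤ X → j - i ≡ X → i ≤ j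
≤-from-difference 0≤X eq = ℤP.0≤i-j⇒j≤i (subst (0ℤ ≤_) (sym eq) 0≤X)

≤-+-nonneg : ∀ {a b : ℤ} → 0ℤ ≤ b → a ≤ a + b
≤-+-nonneg {a} {b} 0≤b = ≤-from-difference 0≤b (a+b-a≡b a b)
  where
  a+b-a≡b : ∀ a b → a + b - a ≡ b
  a+b-a≡b = solve-∀

square-nonneg : ∀ z → 0ℤ ≤ z * z
square-nonneg (+ ℕ.zero) = +≤+ ℕ.z≤n
square-nonneg (+ suc n) = +≤+ ℕ.z≤n
square-nonneg -[1+ n ] = +≤+ ℕ.z≤n

⊕-identityˡ : ∀ {n} (y : ℤ^ n) → replicate n 0ℤ ⊕ y ≡ y
⊕-identityˡ = zipWith-identityˡ ℤP.+-identityˡ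

⊕-∷ʳ : ∀ {n} (x y : ℤ^ n) a b → (x ∷ʳ a) ⊕ (y ∷ʳ b) ≡ (x ⊕ y) ∷ʳ (a + b)
⊕-∷ʳ []ᵥ []ᵥ a b = refl
⊕-∷ʳ (x ∷ᵥ xs) (y ∷ᵥ ys) a b = cong ((x + y) ∷ᵥ_) (⊕-∷ʳ xs ys a b)

⊕-cancelˡ : ∀ {n} (a s t : ℤ^ n) → a ⊕ s ≡ a ⊕ t → s ≡ t
⊕-cancelˡ []ᵥ []ᵥ []ᵥ _ = refl
⊕-cancelˡ (a ∷ᵥ as) (s ∷ᵥ ss) (t ∷ᵥ ts) eq =
  cong₂ _∷ᵥ_ (+-cancelˡ a s t (cong head eq))
             (⊕-cancelˡ as ss ts (cong tail eq))

_⊖_ : ∀ {n} → ℤ^ n → ℤ^ n → ℤ^ n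
_⊖_ = zipWith _-_

⊕-⊖ : ∀ {n} (a y : ℤ^ n) → a ⊕ (y ⊖ a) ≡ y
⊕-⊖ []ᵥ []ᵥ = refl
⊕-⊖ (a ∷ᵥ as) (y ∷ᵥ ys) = cong₂ _∷ᵥ_ (a+[y-a]≡y a y) (⊕-⊖ as ys)
  where
  a+[y-a]≡y : ∀ a y → a + (y - a) ≡ y
  a+[y-a]≡y = solve-∀

module _ {G : Set} (_∙_ : G → G → G) where

  Covers : (A C : G → Set) → Set
  Covers A C = ∀ g → ∃[ a ] ∃[ c ] (A a × C c × a ∙ c ≡ g)

  IsPrivatePoint : (A C : G → Set) → G → G → Set
  IsPrivatePoint A C c₀ g = ∀ a c → A a → C c → a ∙ c ≡ g → c ≡ c₀

  -- C covers G together with A, and each of its elements has a private point;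
  -- classically this is exactly minimality of the complement.
  IsWitnessedMinimalComplement : (A C : G → Set) → Set
  IsWitnessedMinimalComplement A C =
    Covers A C × (∀ c₀ → C c₀ → ∃[ g ] IsPrivatePoint A C c₀ g)

  private-point-reached : ∀ {A C c₀ g} → Covers A C → IsPrivatePoint A C c₀ g →
                          ∃[ a ] (A a × a ∙ c₀ ≡ g)
  private-point-reached covers priv with covers _
  ... | a , c , a∈A , c∈C , a∙c≡g =
    a , a∈A , subst (λ c → a ∙ c ≡ _) (priv a c a∈A c∈C a∙c≡g) a∙c≡g

depth : ∀ {n} → ℤ^ n → ℤ
depth s = - (+ 2 * sumSq s)

lift : ∀ {n} → ℤ^ n → ℤ^ (suc n)
lift s = s ∷ʳ depth s

IsLiftOf : ∀ {n} → Subset n → Subset (suc n) → Set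
IsLiftOf S W' = (∀ s → S s → W' (lift s)) × (∀ v → W' v → ∃[ s ] (S s × v ≡ lift s))

Lifted : ∀ {n} → Subset n → Subset (suc n)
Lifted S v = ∃[ s ] (S s × v ≡ lift s)

Lifted-isLift : ∀ {n} (S : Subset n) → IsLiftOf S (Lifted S)
Lifted-isLift S = (λ s s∈S → s , s∈S , refl) , (λ v v∈ → v∈)

-- The key inequality: coordinatewise 2(x+s)² + 2s² = x² + (x+2s)².
sumSq-bound : ∀ {n} (x s : ℤ^ n) → sumSq x ≤ + 2 * sumSq (x ⊕ s) + + 2 * sumSq s
sumSq-bound []ᵥ []ᵥ = +≤+ ℕ.z≤n
sumSq-bound (x ∷ᵥ xs) (s ∷ᵥ ss) = begin
  x * x + X                                     ≤⟨ ℤP.+-mono-≤ (≤-+-nonneg {x * x} (square-nonneg y)) (sumSq-bound xs ss) ⟩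
  (x * x + y * y) + (+ 2 * Y + + 2 * S)          ≡⟨ regroup x s X Y S ⟩
  + 2 * ((x + s) * (x + s) + Y) + + 2 * (s * s + S) ∎
  where
  open ℤP.≤-Reasoning
  X Y S y : ℤ
  X = sumSq xs
  Y = sumSq (xs ⊕ ss)
  S = sumSq ss
  y = x + + 2 * s
  regroup : ∀ x s X Y S → (x * x + (x + + 2 * s) * (x + + 2 * s)) + (+ 2 * Y + + 2 * S)
                          ≡ + 2 * ((x + s) * (x + s) + Y) + + 2 * (s * s + S)
  regroup = solve-∀

summit-above : ∀ {n} (x s : ℤ^ n) t → t + depth s ≡ + 2 * sumSq (x ⊕ s) → sumSq x ≤ t
summit-above x s t eq =
  subst (sumSq x ≤_) (sym (solve-for-t t (sumSq (x ⊕ s)) (sumSq s) eq)) (sumSq-bound x s)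
  where
  solve-for-t : ∀ t Y S → t - + 2 * S ≡ + 2 * Y → t ≡ + 2 * Y + + 2 * S
  solve-for-t t Y S eq = rearrange eq (solve (t ∷ Y ∷ S ∷ []))

module Lifting {n} {A S : Subset n} {W' : Subset (suc n)}
  (minimal : IsWitnessedMinimalComplement _⊕_ A S) (isLift : IsLiftOf S W') where

  -- The cylinder A × ℤ already covers ℤⁿ⁺¹ together with the lift.
  lift-covers : IsComplement (Wset n A) W'
  lift-covers g with initLast g
  ... | y , u , refl with proj₁ minimal y
  ... | a , s , a∈A , s∈S , a⊕s≡y =
    a ∷ʳ (u - depth s) , lift s , inj₂ (a , u - depth s , refl , a∈A) ,
    proj₁ isLift s s∈S , trans (⊕-∷ʳ a s _ _) (cong₂ _∷ʳ_ a⊕s≡y (u-k+k≡u u (depth s)))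
    where
    u-k+k≡u : ∀ u k → u - k + k ≡ u
    u-k+k≡u = solve-∀

  split-sum : ∀ (x : ℤ^ n) t s {y u} → (x ∷ʳ t) ⊕ lift s ≡ y ∷ʳ u → x ⊕ s ≡ y × t + depth s ≡ u
  split-sum x t s eq = ∷ʳ-injective _ _ (trans (sym (⊕-∷ʳ x s t (depth s))) eq)

  summit-private : ∀ {s₀ y} → IsPrivatePoint _⊕_ A S s₀ y →
                   ∀ w s → Wset n A w → S s → w ⊕ lift s ≡ y ∷ʳ (+ 2 * sumSq y) → s ≡ s₀
  summit-private {y = y} y-private w s (inj₁ (x , t , refl , below)) s∈S eq =
    ⊥-elim (ℤP.≤⇒≯ (ℤP.i≤j⇒0≤j-i (summit-above x s t last≡)) below)
    where
    split : x ⊕ s ≡ y × t + depth s ≡ + 2 * sumSq y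
    split = split-sum x t s eq
    last≡ : t + depth s ≡ + 2 * sumSq (x ⊕ s)
    last≡ = trans (proj₂ split) (cong (λ z → + 2 * sumSq z) (sym (proj₁ split)))
  summit-private y-private w s (inj₂ (x , t , refl , x∈A)) s∈S eq =
    y-private x s x∈A s∈S (proj₁ (split-sum x t s eq))

  lift-minimal : ∀ w' → W' w' → ¬ IsComplement (Wset n A) (λ v → W' v × v ≢ w')
  lift-minimal w' w'∈W' covers' with proj₂ isLift w' w'∈W'
  ... | s₀ , s₀∈S , refl with proj₂ minimal s₀ s₀∈S
  ... | y , y-private with covers' (y ∷ʳ (+ 2 * sumSq y))
  ... | w , v , w∈W , (v∈W' , v≢lift) , eq with proj₂ isLift v v∈W'
  ... | s , s∈S , refl = v≢lift (cong lift (summit-private y-private w s w∈W s∈S eq))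

  lift-minimal-complement : IsMinimalComplement (Wset n A) W'
  lift-minimal-complement = lift-covers , lift-minimal

open Lifting using (lift-minimal-complement)

everything-complements-origin : ∀ n → IsWitnessedMinimalComplement _⊕_ (Origin n) (λ _ → ⊤)
everything-complements-origin n =
  (λ y → replicate n 0ℤ , y , refl , tt , ⊕-identityˡ y) ,
  (λ s₀ _ → s₀ , λ { a s refl _ eq → trans (sym (⊕-identityˡ s)) eq })

Mset-isLift : ∀ n → IsLiftOf (λ _ → ⊤) (Mset n)
Mset-isLift n = (λ s _ → s , refl) , (λ { v (s , eq) → s , tt , eq })

module Greedy (D : List ℕ) where

  Blocked : List ℕ → ℕ → Set
  Blocked H k = Any (λ j → Any (λ d → 0 ℕ.< d × j ℕ.+ d ≡ k) D) H

  blocked? : ∀ H k → Dec (Blocked H k)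
  blocked? H k = any? (λ j → any? (λ d → (0 ℕ.<? d) ×-dec (j ℕ.+ d ℕ.≟ k)) D) H

  chosenBelow : ℕ → List ℕ
  chosenBelow ℕ.zero = []
  chosenBelow (suc k) with blocked? (chosenBelow k) k
  ... | yes _ = chosenBelow k
  ... | no _ = k ∷ chosenBelow k

  Chosen : ℕ → Set
  Chosen k = ¬ Blocked (chosenBelow k) k

  chosenBelow-sound : ∀ {j} k → j ∈ chosenBelow k → Chosen j
  chosenBelow-sound (suc k) j∈ with blocked? (chosenBelow k) k
  ... | yes _ = chosenBelow-sound k j∈
  ... | no unblocked with j∈
  ...   | here refl = unblocked
  ...   | there j∈′ = chosenBelow-sound k j∈′

  chosenBelow-complete : ∀ {j} k → j ℕ.< k → Chosen j → j ∈ chosenBelow k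
  chosenBelow-complete (suc k) j<1+k chosen
    with blocked? (chosenBelow k) k | ℕP.m≤n⇒m<n∨m≡n (ℕ.s≤s⁻¹ j<1+k)
  ... | yes _       | inj₁ j<k = chosenBelow-complete k j<k chosen
  ... | yes blocked | inj₂ refl = ⊥-elim (chosen blocked)
  ... | no _        | inj₁ j<k = there (chosenBelow-complete k j<k chosen)
  ... | no _        | inj₂ refl = here refl

  covers : ∀ k → Chosen k ⊎ ∃[ j ] ∃[ d ] (Chosen j × d ∈ D × j ℕ.+ d ≡ k)
  covers k with blocked? (chosenBelow k) k
  ... | no unblocked = inj₁ unblocked
  ... | yes blocked with find blocked
  ... | j , j∈ , hit with find hit
  ... | d , d∈D , _ , j+d≡k = inj₂ (j , d , chosenBelow-sound k j∈ , d∈D , j+d≡k)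

  separated : ∀ {j k d} → Chosen j → Chosen k → d ∈ D → j ℕ.+ d ≡ k → d ≡ 0
  separated {d = ℕ.zero} _ _ _ _ = refl
  separated {j} {d = suc d} chosen-j chosen-k d∈D refl =
    ⊥-elim (chosen-k (lose j∈ (lose d∈D (ℕ.s≤s ℕ.z≤n , refl))))
    where
    j∈ : j ∈ chosenBelow (j ℕ.+ suc d)
    j∈ = chosenBelow-complete _ (ℕP.m<m+n j (ℕ.s≤s ℕ.z≤n)) chosen-j

module HalfLine (B : List ℤ) (β : ℤ) (β∈B : β ∈ B) (β-min : ∀ {b} → b ∈ B → β ≤ b) where

  offset : ℤ → ℕ
  offset b = ∣ b - β ∣

  offset-correct : ∀ {b} → β ≤ b → + offset b ≡ b - β
  offset-correct β≤b = ℤP.0≤i⇒+∣i∣≡i (ℤP.i≤j⇒0≤j-i β≤b)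

  open Greedy (map offset B)

  H : ℤ → Set
  H c = ∃[ k ] (c ≡ + k × Chosen k)

  H-nonneg : ∀ {c} → H c → 0ℤ ≤ c
  H-nonneg (k , refl , _) = +≤+ ℕ.z≤n

  offset-sum : ∀ {b m} k → β ≤ b → β ≤ m → k ℕ.+ offset b ≡ offset m → b + + k ≡ m
  offset-sum {b} {m} k β≤b β≤m eq = cancel-β b m β (+ k) in-ℤ
    where
    cancel-β : ∀ b m β K → K + (b - β) ≡ m - β → b + K ≡ m
    cancel-β b m β K e = rearrange e (solve (b ∷ m ∷ β ∷ K ∷ []))
    in-ℤ : + k + (b - β) ≡ m - β
    in-ℤ = begin
      + k + (b - β)        ≡⟨ cong (_+_ (+ k)) (offset-correct β≤b) ⟨
      + k + + offset b     ≡⟨ ℤP.pos-+ k (offset b) ⟨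
      + (k ℕ.+ offset b)   ≡⟨ cong +_ eq ⟩
      + offset m           ≡⟨ offset-correct β≤m ⟩
      m - β                ∎
      where open ≡-Reasoning

  H-covers : ∀ m → β ≤ m → ∃[ b ] ∃[ c ] (b ∈ B × H c × b + c ≡ m)
  H-covers m β≤m with covers (offset m)
  ... | inj₁ chosen =
    β , + offset m , β∈B , (offset m , refl , chosen) ,
    offset-sum (offset m) ℤP.≤-refl β≤m (trans (cong (offset m ℕ.+_) offset-β) (ℕP.+-identityʳ _))
    where
    offset-β : offset β ≡ 0
    offset-β = cong ∣_∣ (ℤP.+-inverseʳ β)
  ... | inj₂ (j , d , chosen , d∈ , j+d≡) with ∈-map⁻ offset d∈
  ... | b , b∈B , refl = b , + j , b∈B , (j , refl , chosen) , offset-sum j (β-min b∈B) β≤m j+d≡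

  H-private : ∀ {b c c₀} → b ∈ B → H c → H c₀ → b + c ≡ β + c₀ → c ≡ c₀
  H-private {b} b∈B (k , refl , chosen) (k₀ , refl , chosen₀) eq =
    cong +_ (trans (sym (ℕP.+-identityʳ k)) (subst (λ d → k ℕ.+ d ≡ k₀) offset-b≡0 k+d≡k₀))
    where
    k+d≡k₀ : k ℕ.+ offset b ≡ k₀
    k+d≡k₀ = ℤP.+-injective (begin
      + (k ℕ.+ offset b)   ≡⟨ ℤP.pos-+ k (offset b) ⟩
      + k + + offset b     ≡⟨ cong (_+_ (+ k)) (offset-correct (β-min b∈B)) ⟩
      + k + (b - β)        ≡⟨ move-β b (+ k) β (+ k₀) eq ⟩
      + k₀                 ∎)
      where
      open ≡-Reasoning
      move-β : ∀ b K β K₀ → b + K ≡ β + K₀ → K + (b - β) ≡ K₀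
      move-β b K β K₀ e = rearrange e (solve (b ∷ K ∷ β ∷ K₀ ∷ []))
    offset-b≡0 : offset b ≡ 0
    offset-b≡0 = separated chosen chosen₀ (∈-map⁺ offset b∈B) k+d≡k₀

map-≢[] : ∀ {X Y : Set} (f : X → Y) {xs : List X} → xs ≢ [] → map f xs ≢ []
map-≢[] f {[]}    xs≢[] _  = xs≢[] refl
map-≢[] f {_ ∷ _} _     ()

minimum : (B : List ℤ) → B ≢ [] → ∃[ β ] (β ∈ B × (∀ {b} → b ∈ B → β ≤ b))
minimum []       B≢[] = ⊥-elim (B≢[] refl)
minimum (x ∷ xs) _    =
  min x xs ,
  argmin-all (λ z → z) {P = _∈ x ∷ xs} (here refl) (ListAll.tabulate there) ,
  ListAll.lookup (min≤⊤ x xs ListAll.∷ min≤xs x xs)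
  where open Data.List.Extrema ℤP.≤-totalOrder using (min; argmin-all; min≤⊤; min≤xs)

-- The whole line: the upper half-line part for B above min B, and the mirror image
-- (the upper part for -B) placed below min B - max B.
module Line (B : List ℤ) (B≢[] : B ≢ []) where

  β : ℤ
  β = proj₁ (minimum B B≢[])

  β∈B : β ∈ B
  β∈B = proj₁ (proj₂ (minimum B B≢[]))

  β-min : ∀ {b} → b ∈ B → β ≤ b
  β-min = proj₂ (proj₂ (minimum B B≢[]))

  -B : List ℤ
  -B = map -_ B

  -B≢[] : -B ≢ []
  -B≢[] = map-≢[] -_ B≢[]

  -- β′ = - max B
  β′ : ℤ
  β′ = proj₁ (minimum -B -B≢[])

  β′∈-B : β′ ∈ -B
  β′∈-B = proj₁ (proj₂ (minimum -B -B≢[]))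

  β′-min : ∀ {b} → b ∈ -B → β′ ≤ b
  β′-min = proj₂ (proj₂ (minimum -B -B≢[]))

  module Up = HalfLine B β β∈B β-min
  module Down = HalfLine -B β′ β′∈-B β′-min

  δ : ℤ
  δ = β - 1ℤ + β′

  C : ℤ → Set
  C c = Up.H c ⊎ Down.H (δ - c)

  lower-below : ∀ {b c} → b ∈ B → Down.H (δ - c) → b + c < β
  lower-below {b} {c} b∈B h = ℤP.suc[i]≤j⇒i<j (≤-from-difference
    (ℤP.+-mono-≤ (ℤP.i≤j⇒0≤j-i (β′-min (∈-map⁺ -_ b∈B))) (Down.H-nonneg h))
    (gap b c β β′))
    where
    gap : ∀ b c β β′ → β - (1ℤ + (b + c)) ≡ (- b - β′) + (β - 1ℤ + β′ - c)
    gap = solve-∀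

  upper-above : ∀ {b c} → b ∈ B → Up.H c → β ≤ b + c
  upper-above b∈B h = ℤP.≤-trans (β-min b∈B) (≤-+-nonneg (Up.H-nonneg h))

  β′≤δ-m : ∀ {m} → ¬ β ≤ m → β′ ≤ δ - m
  β′≤δ-m {m} β≰m = ≤-from-difference (ℤP.i≤j⇒0≤j-i (ℤP.i<j⇒suc[i]≤j (ℤP.≰⇒> β≰m))) (gap β β′ m)
    where
    gap : ∀ β β′ m → β - 1ℤ + β′ - m - β′ ≡ β - (1ℤ + m)
    gap = solve-∀

  reflect : ∀ b c′ δ m → - b + c′ ≡ δ - m → b + (δ - c′) ≡ m
  reflect b c′ δ m e = rearrange (sym e) (solve (b ∷ c′ ∷ δ ∷ m ∷ []))

  δ-δ-c : ∀ δ c → δ - (δ - c) ≡ c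
  δ-δ-c = solve-∀

  C-covers : Covers _+_ (_∈ B) C
  C-covers m with β ≤? m
  ... | yes β≤m with Up.H-covers m β≤m
  ...   | b , c , b∈B , h , eq = b , c , b∈B , inj₁ h , eq
  C-covers m | no β≰m with Down.H-covers (δ - m) (β′≤δ-m β≰m)
  ... | b′ , c′ , b′∈-B , h , eq with ∈-map⁻ -_ b′∈-B
  ...   | b , b∈B , refl =
    b , δ - c′ , b∈B , inj₂ (subst Down.H (sym (δ-δ-c δ c′)) h) , reflect b c′ δ m eq

  negate : ∀ b c b₀ c₀ δ → b + c ≡ b₀ + c₀ → - b + (δ - c) ≡ - b₀ + (δ - c₀)
  negate b c b₀ c₀ δ e = rearrange (sym e) (solve (b ∷ c ∷ b₀ ∷ c₀ ∷ δ ∷ []))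

  cancel-δ : ∀ δ c c₀ → δ - c ≡ δ - c₀ → c ≡ c₀
  cancel-δ δ c c₀ e = rearrange (sym e) (solve (δ ∷ c ∷ c₀ ∷ []))

  C-private : ∀ c₀ → C c₀ → ∃[ g ] IsPrivatePoint _+_ (_∈ B) C c₀ g
  C-private c₀ (inj₁ h₀) = β + c₀ , λ where
    b c b∈B (inj₁ h) eq → Up.H-private b∈B h h₀ eq
    b c b∈B (inj₂ h) eq →
      ⊥-elim (ℤP.≤⇒≯ (≤-+-nonneg (Up.H-nonneg h₀)) (subst (_< β) eq (lower-below b∈B h)))
  C-private c₀ (inj₂ h₀) with ∈-map⁻ -_ β′∈-B
  ... | b₀ , b₀∈B , β′≡-b₀ = b₀ + c₀ , λ where
    b c b∈B (inj₁ h) eq →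
      ⊥-elim (ℤP.≤⇒≯ (upper-above b∈B h) (subst (_< β) (sym eq) (lower-below b₀∈B h₀)))
    b c b∈B (inj₂ h) eq →
      cancel-δ δ c c₀ (Down.H-private (∈-map⁺ -_ b∈B) h h₀
        (subst (λ z → - b + (δ - c) ≡ z + (δ - c₀)) (sym β′≡-b₀) (negate b c b₀ c₀ δ eq)))

finite-ℤ-minimal-complement : (B : List ℤ) → B ≢ [] →
                              ∃[ C ] IsWitnessedMinimalComplement _+_ (_∈ B) C
finite-ℤ-minimal-complement B B≢[] = C , C-covers , C-private
  where open Line B B≢[]

module Pullback {n} {A : Subset n} {B C : ℤ → Set} (ψ : ℤ^ n → ℤ)
  (additive : ∀ x y → ψ (x ⊕ y) ≡ ψ x + ψ y)
  (injective : ∀ {a a′} → A a → A a′ → ψ a ≡ ψ a′ → a ≡ a′)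
  (image⁺ : ∀ {a} → A a → B (ψ a))
  (image⁻ : ∀ {b} → B b → ∃[ a ] (A a × b ≡ ψ a))
  (minimal : IsWitnessedMinimalComplement _+_ B C) where

  pullback-covers : Covers _⊕_ A (λ s → C (ψ s))
  pullback-covers y with proj₁ minimal (ψ y)
  ... | b , c , b∈B , c∈C , b+c≡ψy with image⁻ b∈B
  ... | a , a∈A , refl = a , y ⊖ a , a∈A , subst C (sym ψ[y⊖a]≡c) c∈C , ⊕-⊖ a y
    where
    ψ[y⊖a]≡c : ψ (y ⊖ a) ≡ c
    ψ[y⊖a]≡c = +-cancelˡ (ψ a) _ _ (trans (sym (additive a (y ⊖ a))) (trans (cong ψ (⊕-⊖ a y)) (sym b+c≡ψy)))

  pullback-private : ∀ s₀ → C (ψ s₀) → ∃[ y ] IsPrivatePoint _⊕_ A (λ s → C (ψ s)) s₀ y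
  pullback-private s₀ c₀∈C with proj₂ minimal (ψ s₀) c₀∈C
  ... | g , g-private with private-point-reached _+_ (proj₁ minimal) g-private
  ... | b₀ , b₀∈B , b₀+c₀≡g with image⁻ b₀∈B
  ... | a₀ , a₀∈A , refl = a₀ ⊕ s₀ , private-y
    where
    private-y : IsPrivatePoint _⊕_ A (λ s → C (ψ s)) s₀ (a₀ ⊕ s₀)
    private-y a s a∈A s∈S eq = ⊕-cancelˡ a₀ s s₀ (subst (λ z → z ⊕ s ≡ a₀ ⊕ s₀) a≡a₀ eq)
      where
      ψ-sum : ψ a + ψ s ≡ ψ a₀ + ψ s₀
      ψ-sum = trans (sym (additive a s)) (trans (cong ψ eq) (additive a₀ s₀))
      ψs≡ψs₀ : ψ s ≡ ψ s₀
      ψs≡ψs₀ = g-private (ψ a) (ψ s) (image⁺ a∈A) s∈S (trans ψ-sum b₀+c₀≡g)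
      a≡a₀ : a ≡ a₀
      a≡a₀ = injective a∈A a₀∈A
        (+-cancelʳ (ψ s₀) _ _ (subst (λ z → ψ a + z ≡ ψ a₀ + ψ s₀) ψs≡ψs₀ ψ-sum))

  pullback-minimal : IsWitnessedMinimalComplement _⊕_ A (λ s → C (ψ s))
  pullback-minimal = pullback-covers , pullback-private

digits : ℤ → ∀ {n} → ℤ^ n → ℤ
digits M []ᵥ       = 0ℤ
digits M (x ∷ᵥ xs) = x + M * digits M xs

digits-additive : ∀ M {n} (x y : ℤ^ n) → digits M (x ⊕ y) ≡ digits M x + digits M y
digits-additive M []ᵥ []ᵥ = refl
digits-additive M (x ∷ᵥ xs) (y ∷ᵥ ys) =
  trans (cong (λ p → x + y + M * p) (digits-additive M xs ys)) (regroup x y M (digits M xs) (digits M ys))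
  where
  regroup : ∀ x y M p q → x + y + M * (p + q) ≡ x + M * p + (y + M * q)
  regroup = solve-∀

Bounded : ℕ → ∀ {n} → ℤ^ n → Set
Bounded T = All (λ z → ∣ z ∣ ℕ.≤ T)

height : ∀ {n} → ℤ^ n → ℕ
height []ᵥ       = 0
height (x ∷ᵥ xs) = ∣ x ∣ ℕ.⊔ height xs

height-bounds : ∀ {T n} (x : ℤ^ n) → height x ℕ.≤ T → Bounded T x
height-bounds []ᵥ       _ = []ᵃ
height-bounds (x ∷ᵥ xs) h =
  ℕP.≤-trans (ℕP.m≤m⊔n _ _) h ∷ᵃ height-bounds xs (ℕP.≤-trans (ℕP.m≤n⊔m _ _) h)

small-multiple : ∀ T r → ∣ + suc (T ℕ.+ T) * r ∣ ℕ.≤ T ℕ.+ T → r ≡ 0ℤ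
small-multiple T r small = ℤP.∣i∣≡0⇒i≡0 (ℕP.n<1⇒n≡0 (ℕP.*-cancelˡ-< M ∣ r ∣ 1 M∣r∣<M))
  where
  open ℕP.≤-Reasoning
  M : ℕ
  M = suc (T ℕ.+ T)
  M∣r∣<M : M ℕ.* ∣ r ∣ ℕ.< M ℕ.* 1
  M∣r∣<M = begin-strict
    M ℕ.* ∣ r ∣   ≡⟨ ℤP.abs-* (+ M) r ⟨
    ∣ + M * r ∣   ≤⟨ small ⟩
    T ℕ.+ T       <⟨ ℕP.n<1+n _ ⟩
    M             ≡⟨ ℕP.*-identityʳ M ⟨
    M ℕ.* 1       ∎

digits-injective : ∀ T {n} {x y : ℤ^ n} → Bounded T x → Bounded T y →
                   digits (+ suc (T ℕ.+ T)) x ≡ digits (+ suc (T ℕ.+ T)) y → x ≡ y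
digits-injective T {x = []ᵥ} {[]ᵥ} []ᵃ []ᵃ _ = refl
digits-injective T {x = x ∷ᵥ xs} {y ∷ᵥ ys} (∣x∣≤T ∷ᵃ xs-bounded) (∣y∣≤T ∷ᵃ ys-bounded) eq =
  cong₂ _∷ᵥ_ x≡y (digits-injective T xs-bounded ys-bounded p≡q)
  where
  M p q : ℤ
  M = + suc (T ℕ.+ T)
  p = digits M xs
  q = digits M ys
  difference : ∀ x y M p q → x + M * p ≡ y + M * q → x - y ≡ M * (q - p)
  difference x y M p q e = rearrange e (solve (x ∷ y ∷ M ∷ p ∷ q ∷ []))
  x-y≡ : x - y ≡ M * (q - p)
  x-y≡ = difference x y M p q eq
  q-p≡0 : q - p ≡ 0ℤ
  q-p≡0 = small-multiple T (q - p) (subst (λ z → ∣ z ∣ ℕ.≤ T ℕ.+ T) x-y≡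
            (ℕP.≤-trans (ℤP.∣i-j∣≤∣i∣+∣j∣ x y) (ℕP.+-mono-≤ ∣x∣≤T ∣y∣≤T)))
  p≡q : p ≡ q
  p≡q = sym (ℤP.i-j≡0⇒i≡j q p q-p≡0)
  x≡y : x ≡ y
  x≡y = ℤP.i-j≡0⇒i≡j x y (trans x-y≡ (trans (cong (M *_) q-p≡0) (ℤP.*-zeroʳ M)))

finite-minimal-complement : ∀ {n} (L : List (ℤ^ n)) → L ≢ [] →
                            ∃[ S ] IsWitnessedMinimalComplement _⊕_ (ListSet L) S
finite-minimal-complement L L≢[] =
  (λ s → C (ψ s)) ,
  pullback-minimal ψ (digits-additive M) injective (∈-map⁺ ψ) (∈-map⁻ ψ) C-minimal
  where
  open Data.List.Extrema ℕP.≤-totalOrder using (max; xs≤max)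
  open Pullback using (pullback-minimal)
  T : ℕ
  T = max 0 (map height L)
  M : ℤ
  M = + suc (T ℕ.+ T)
  ψ : ℤ^ _ → ℤ
  ψ = digits M
  bounded : ∀ {a} → a ∈ L → Bounded T a
  bounded a∈L = height-bounds _ (ListAll.lookup (xs≤max 0 (map height L)) (∈-map⁺ height a∈L))
  injective : ∀ {a a′} → a ∈ L → a′ ∈ L → ψ a ≡ ψ a′ → a ≡ a′
  injective a∈L a′∈L = digits-injective T (bounded a∈L) (bounded a′∈L)
  C : ℤ → Set
  C = proj₁ (finite-ℤ-minimal-complement (map ψ L) (map-≢[] ψ L≢[]))
  C-minimal : IsWitnessedMinimalComplement _+_ (_∈ map ψ L) C
  C-minimal = proj₂ (finite-ℤ-minimal-complement (map ψ L) (map-≢[] ψ L≢[]))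

lifted-nonempty : ∀ {n} {A S : Subset n} → Covers _⊕_ A S → NonEmpty (Lifted S)
lifted-nonempty {n} covers with covers (replicate n 0ℤ)
... | _ , s , _ , s∈S , _ = lift s , s , s∈S , refl

corollary4p9 : (∀ (n : ℕ) → IsMinimalComplement (Wset (suc n) (Origin (suc n))) (Mset (suc n)))
    × (∀ (n : ℕ) (A : List (ℤ^ (suc n))) → A ≢ []
         → ∃[ W' ] (NonEmpty W' × IsMinimalComplement (Wset (suc n) (ListSet A)) W'))
corollary4p9 = part₁ , part₂
  where
  part₁ : ∀ n → IsMinimalComplement (Wset (suc n) (Origin (suc n))) (Mset (suc n))
  part₁ n = lift-minimal-complement (everything-complements-origin (suc n)) (Mset-isLift (suc n))

  part₂ : ∀ n (A : List (ℤ^ (suc n))) → A ≢ [] →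
          ∃[ W' ] (NonEmpty W' × IsMinimalComplement (Wset (suc n) (ListSet A)) W')
  part₂ n A A≢[] with finite-minimal-complement A A≢[]
  ... | S , S-minimal =
    Lifted S , lifted-nonempty (proj₁ S-minimal) , lift-minimal-complement S-minimal (Lifted-isLift S)
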